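{- Let $\sigma\in S_n$ and let $A,B$ be disjoint $k$-sets with $\sigma_{\langle A\rangle}=\sigma_{\langle B\rangle}$. If two chains in the chain graph of $\sigma$ for $A$ and $B$ overlap horizontally, then either both are oriented leftwards or both are oriented rightwards. If two chains overlap vertically, then either both are oriented upwards or both are oriented downwards.
   Context: $S_n$ is the set of permutations of $[n]$. Points of $\sigma$ are $(i,\sigma(i))$, identified with positions $i$ and ordered left to right. For $A\subset[n]$, $\sigma_{\langle A\rangle}$ is the permutation in the same relative order as the word obtained by deleting the entries at positions in $A$; if $[n]\setminus A=\{i_1<\dots<i_r\}$, the $i_j$th entry of $\sigma$ fulfills the $j$th entry of $\sigma_{\langle A\rangle}$. For disjoint $k$-sets $A,B$ with $\sigma_{\langle A\rangle}=\sigma_{\langle B\rangle}$, the chain graph has vertex set the points of $\sigma$; for each $i\in[n-k]$ an edge joins the point fulfilling the $i$th entry of $\sigma_{\langle A\rangle}$ and the point fulfilling the $i$th entry of $\sigma_{\langle B\rangle}$ when these differ. Points in $A$ are red, in $B$ blue. The chains are the connected components with at least one edge; each chain is a monotone path with one red end-vertex and one blue end-vertex. A chain is oriented leftwards, rightwards, upwards, or downwards according as its blue end-vertex is to the left of, to the right of, above, or below its red end-vertex. Chains $C,C'$ with left end-vertices $\ell,\ell'$ and right end-vertices $r,r'$ overlap horizontally if $\ell<r'$ and $\ell'<r$; with lower end-vertices $b,b'$ and upper end-vertices $t,t'$ they overlap vertically if $\sigma(b)<\sigma(t')$ and $\sigma(b')<\sigma(t)$. -}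

module Defs where

open import Data.Nat using (ℕ; _<_; _⊓_; _⊔_)
open import Data.Nat.Properties using (_<?_)
open import Data.Fin using (Fin; toℕ)
open import Data.Fin.Subset using (Subset; _∈_; _∉_)
open import Data.Fin.Subset.Properties using (_∈?_)
open import Data.Fin.Permutation using (Permutation′; _⟨$⟩ʳ_)
open import Data.List using (List; map; filter; length; zip; allFin)
open import Data.List.Membership.Propositional using () renaming (_∈_ to _∈ₗ_)
open import Data.Product using (_×_; _,_)
open import Data.Sum using (_⊎_)
open import Relation.Nullary using (¬?)
open import Relation.Binary.PropositionalEquality using (_≡_; _≢_)
open import Relation.Binary.Construct.Closure.ReflexiveTransitive using (Star)

-- Points of σ are identified with positions i : Fin n; the value is σ ⟨$⟩ʳ i.
value : ∀ {n} → Permutation′ n → Fin n → ℕ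
value σ i = toℕ (σ ⟨$⟩ʳ i)

-- Positions not in A, in increasing order (left to right).
-- The j-th element of this list is the point fulfilling the j-th entry of σ⟨A⟩.
kept : ∀ {n} → Subset n → List (Fin n)
kept {n} A = filter (λ i → ¬? (i ∈? A)) (allFin n)

-- Standardisation of a word of distinct naturals: each entry is replaced by
-- its rank (number of smaller entries), giving the permutation (0-based)
-- in the same relative order.
std : List ℕ → List ℕ
std w = map (λ x → length (filter (_<? x) w)) w

delete : ∀ {n} → Permutation′ n → Subset n → List ℕ
delete σ A = std (map (value σ) (kept A))

Edge : ∀ {n} → Subset n → Subset n → Fin n → Fin n → Set
Edge A B p q = (((p , q) ∈ₗ zip (kept A) (kept B)) ⊎ ((q , p) ∈ₗ zip (kept A) (kept B))) × p ≢ q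

Connected : ∀ {n} → Subset n → Subset n → Fin n → Fin n → Set
Connected A B = Star (Edge A B)

-- A chain (a connected component with at least one edge) is a monotone path
-- with exactly one red end-vertex (in A) and one blue end-vertex (in B);
-- it is determined by, and represented by, these two end-vertices, which lie
-- in the same connected component.
record Chain {n} (A B : Subset n) : Set where
  field
    red       : Fin n
    blue      : Fin n
    red∈A     : red ∈ A
    blue∈B    : blue ∈ B
    connected : Connected A B red blue
open Chain public

module _ {n} {A B : Subset n} (σ : Permutation′ n) where

  Leftwards Rightwards Upwards Downwards : Chain A B → Set
  Leftwards  C = toℕ (blue C) < toℕ (red C)
  Rightwards C = toℕ (red C) < toℕ (blue C)
  Upwards    C = value σ (red C) < value σ (blue C)
  Downwards  C = value σ (blue C) < value σ (red C)

  leftPos rightPos lowVal highVal : Chain A B → ℕ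
  leftPos  C = toℕ (red C) ⊓ toℕ (blue C)
  rightPos C = toℕ (red C) ⊔ toℕ (blue C)
  lowVal   C = value σ (red C) ⊓ value σ (blue C)
  highVal  C = value σ (red C) ⊔ value σ (blue C)

  OverlapH OverlapV : Chain A B → Chain A B → Set
  OverlapH C C' = leftPos C < rightPos C' × leftPos C' < rightPos C
  OverlapV C C' = lowVal C < highVal C' × lowVal C' < highVal C

-- Let x ⟶ y mean that x fulfils, in σ⟨B⟩, the entry that y fulfils in σ⟨A⟩.
-- Each point has at most one ⟶-predecessor and a red point has none, so a
-- chain is a ⟶-path from its red to its blue end-vertex. Since σ⟨A⟩ and
-- σ⟨B⟩ are listed left to right and are equal as patterns, ⟶ preserves
-- both the horizontal and the vertical order of points. If an ascending and
-- a descending path overlapped, both would cross the level v = max of their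
-- lower ends by a single step; the ascending step then starts at or below v
-- and ends above, the descending step the other way round, and comparing the
-- targets of the two steps contradicts order preservation.
module Submission where

open import Defs
open import Data.Nat using (ℕ)
open import Data.Fin.Subset using (Subset; ∣_∣; _∩_; Empty)
open import Data.Fin.Permutation using (Permutation′)
open import Data.Product using (_×_)
open import Data.Sum using (_⊎_)
open import Relation.Binary.PropositionalEquality using (_≡_)

open import Data.Nat using (_<_; _≤_; _⊓_; _⊔_)
open import Data.Nat.Properties
open import Data.Fin using (Fin; toℕ)
import Data.Fin as Fin
open import Data.Fin.Properties using (toℕ-injective)
import Data.Fin.Properties as Finₚ
open import Data.Fin.Subset using (_∈_)
open import Data.Fin.Subset.Properties using (_∈?_; x∈p∩q⁺)
open import Data.List using (List; []; _∷_; map; filter; length; zip; allFin)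
open import Data.List.Membership.Propositional using () renaming (_∈_ to _∈ₗ_)
open import Data.List.Membership.Propositional.Properties using (∈-filter⁺; ∈-filter⁻; ∈-map⁺)
open import Data.List.Properties using (∷-injectiveˡ; ∷-injectiveʳ; zip-map; filter-notAll; filter-reject)
open import Data.List.Relation.Binary.Sublist.Propositional using (⊆-refl)
import Data.List.Relation.Binary.Sublist.Propositional.Properties as Sublist
open import Data.List.Relation.Unary.Any as Any using (Any; here; there)
open import Data.List.Relation.Unary.All as All using ()
open import Data.List.Relation.Unary.AllPairs as AllPairs using (AllPairs; _∷_)
import Data.List.Relation.Unary.AllPairs.Properties as AllPairsₚ
open import Data.List.Relation.Unary.Unique.Propositional using (Unique)
open import Data.Product using (∃₂; _,_; proj₂)
import Data.Product as Product
open import Data.Sum using (inj₁; inj₂; swap)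
open import Data.Empty using (⊥; ⊥-elim)
open import Function using (Injection; _∘_)
open import Function.Properties.Inverse using (↔⇒↣)
open import Relation.Binary using (Rel; Asymmetric; tri<; tri≈; tri>)
open import Relation.Binary.Construct.Closure.ReflexiveTransitive as Star using (Star; ε; _◅_; _◅◅_)
open import Relation.Binary.Construct.Closure.Symmetric using (SymClosure; fwd; bwd)
open import Relation.Binary.PropositionalEquality using (refl; sym; trans; cong; subst; subst₂; _≢_)
open import Relation.Nullary using (¬_; ¬?; yes; no)
open import Relation.Unary using (Pred; Decidable)

⊓<⊔⇒<ˡ : ∀ {m n o p} → m ≤ n → p ≤ o → m ⊓ n < o ⊔ p → m < o
⊓<⊔⇒<ˡ m≤n p≤o = subst₂ _<_ (m≤n⇒m⊓n≡m m≤n) (m≥n⇒m⊔n≡m p≤o)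

⊓<⊔⇒<ʳ : ∀ {m n o p} → n ≤ m → o ≤ p → m ⊓ n < o ⊔ p → n < p
⊓<⊔⇒<ʳ n≤m o≤p = subst₂ _<_ (m≥n⇒m⊓n≡n n≤m) (m≤n⇒m⊔n≡n o≤p)

module LevelCrossing {a ℓ} {X : Set a} (g : X → ℕ) {_⟶_ : Rel X ℓ}
  (⟶-preserves-< : ∀ {x y x′ y′} → x ⟶ y → x′ ⟶ y′ → g y < g y′ → g x < g x′) where

  ascent-across : ∀ {x y} v → Star _⟶_ x y → g x ≤ v → v < g y →
                  ∃₂ λ u w → u ⟶ w × g u ≤ v × v < g w
  ascent-across v ε x≤v v<x = ⊥-elim (<⇒≱ v<x x≤v)
  ascent-across v (_◅_ {j = z} x⟶z z⟶*y) x≤v v<y with g z ≤? v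
  ... | yes z≤v = ascent-across v z⟶*y z≤v v<y
  ... | no  z≰v = _ , _ , x⟶z , x≤v , ≰⇒> z≰v

  descent-across : ∀ {x y} v → Star _⟶_ x y → g y ≤ v → v < g x →
                   ∃₂ λ u w → u ⟶ w × g w ≤ v × v < g u
  descent-across v ε x≤v v<x = ⊥-elim (<⇒≱ v<x x≤v)
  descent-across v (_◅_ {j = z} x⟶z z⟶*y) y≤v v<x with v <? g z
  ... | yes v<z = descent-across v z⟶*y y≤v v<z
  ... | no  v≮z = _ , _ , x⟶z , ≮⇒≥ v≮z , v<x

  ascending-descending-disjoint : ∀ {r b r′ b′} → Star _⟶_ r b → Star _⟶_ r′ b′ →
    g r < g b → g b′ < g r′ → g r < g r′ → g b′ < g b → ⊥
  ascending-descending-disjoint {r} {b} {r′} {b′} r⟶*b r′⟶*b′ r<b b′<r′ r<r′ b′<b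
    with ascent-across v r⟶*b (m≤m⊔n (g r) (g b′)) (⊔-pres-<m r<b b′<b)
       | descent-across v r′⟶*b′ (m≤n⊔m (g r) (g b′)) (⊔-pres-<m r<r′ b′<r′)
    where v = g r ⊔ g b′
  ... | _ , _ , u⟶w , u≤v , v<w | _ , _ , u′⟶w′ , w′≤v , v<u′ =
    <⇒≱ (⟶-preserves-< u′⟶w′ u⟶w (≤-<-trans w′≤v v<w)) (≤-trans u≤v (<⇒≤ v<u′))

  overlapping-paths-codirected : ∀ {r b r′ b′} → Star _⟶_ r b → Star _⟶_ r′ b′ →
    g r ≢ g b → g r′ ≢ g b′ → g r ⊓ g b < g r′ ⊔ g b′ → g r′ ⊓ g b′ < g r ⊔ g b →
    (g r < g b × g r′ < g b′) ⊎ (g b < g r × g b′ < g r′)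
  overlapping-paths-codirected {r} {b} {r′} {b′} p p′ r≢b r′≢b′ o o′
    with <-cmp (g r) (g b) | <-cmp (g r′) (g b′)
  ... | tri≈ _ r≡b _ | _              = ⊥-elim (r≢b r≡b)
  ... | _            | tri≈ _ r′≡b′ _ = ⊥-elim (r′≢b′ r′≡b′)
  ... | tri< r<b _ _ | tri< r′<b′ _ _ = inj₁ (r<b , r′<b′)
  ... | tri> _ _ b<r | tri> _ _ b′<r′ = inj₂ (b<r , b′<r′)
  ... | tri< r<b _ _ | tri> _ _ b′<r′ = ⊥-elim (ascending-descending-disjoint p p′ r<b b′<r′
    (⊓<⊔⇒<ˡ (<⇒≤ r<b) (<⇒≤ b′<r′) o) (⊓<⊔⇒<ʳ (<⇒≤ b′<r′) (<⇒≤ r<b) o′))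
  ... | tri> _ _ b<r | tri< r′<b′ _ _ = ⊥-elim (ascending-descending-disjoint p′ p r′<b′ b<r
    (⊓<⊔⇒<ˡ (<⇒≤ r′<b′) (<⇒≤ b<r) o′) (⊓<⊔⇒<ʳ (<⇒≤ b<r) (<⇒≤ r′<b′) o))

module _ {a ℓ} {X : Set a} {_⟶_ : Rel X ℓ}
  (⟶-injective : ∀ {x x′ y} → x ⟶ y → x′ ⟶ y → x ≡ x′) where

  reaches-predecessor : ∀ {u y w} → Star _⟶_ u y → w ⟶ y → u ≡ y ⊎ Star _⟶_ u w
  reaches-predecessor ε w⟶y = inj₁ refl
  reaches-predecessor (u⟶z ◅ z⟶*y) w⟶y with reaches-predecessor z⟶*y w⟶y
  ... | inj₁ refl  = inj₂ (subst (Star _⟶_ _) (⟶-injective u⟶z w⟶y) ε)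
  ... | inj₂ z⟶*w = inj₂ (u⟶z ◅ z⟶*w)

  reachable-from-source : ∀ {r x y} → (∀ {w} → ¬ (w ⟶ r)) →
    Star _⟶_ r x → Star (SymClosure _⟶_) x y → Star _⟶_ r y
  reachable-from-source source r⟶*x ε = r⟶*x
  reachable-from-source source r⟶*x (fwd x⟶z ◅ z~y) =
    reachable-from-source source (r⟶*x ◅◅ x⟶z ◅ ε) z~y
  reachable-from-source source r⟶*x (bwd z⟶x ◅ z~y) with reaches-predecessor r⟶*x z⟶x
  ... | inj₁ refl  = ⊥-elim (source z⟶x)
  ... | inj₂ r⟶*z = reachable-from-source source r⟶*z z~y

module _ {a b} {A : Set a} {B : Set b} where

  ∈-zip⁻ˡ : ∀ {xs : List A} {ys : List B} {x y} → (x , y) ∈ₗ zip xs ys → x ∈ₗ xs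
  ∈-zip⁻ˡ {_ ∷ _} {_ ∷ _} (here refl) = here refl
  ∈-zip⁻ˡ {_ ∷ _} {_ ∷ _} (there m)   = there (∈-zip⁻ˡ m)

  ∈-zip⁻ʳ : ∀ {xs : List A} {ys : List B} {x y} → (x , y) ∈ₗ zip xs ys → y ∈ₗ ys
  ∈-zip⁻ʳ {_ ∷ _} {_ ∷ _} (here refl) = here refl
  ∈-zip⁻ʳ {_ ∷ _} {_ ∷ _} (there m)   = there (∈-zip⁻ʳ m)

  ∈-zip-functional : ∀ {xs : List A} {ys : List B} → Unique xs → ∀ {x y z} →
    (x , y) ∈ₗ zip xs ys → (x , z) ∈ₗ zip xs ys → y ≡ z
  ∈-zip-functional {_ ∷ _} {_ ∷ _} _ (here refl) (here refl) = refl
  ∈-zip-functional {_ ∷ _} {_ ∷ _} (x∉xs ∷ _) (here refl) (there m) =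
    ⊥-elim (All.lookup x∉xs (∈-zip⁻ˡ m) refl)
  ∈-zip-functional {_ ∷ _} {_ ∷ _} (x∉xs ∷ _) (there m) (here refl) =
    ⊥-elim (All.lookup x∉xs (∈-zip⁻ˡ m) refl)
  ∈-zip-functional {_ ∷ _} {_ ∷ _} (_ ∷ xs!) (there m) (there m′) =
    ∈-zip-functional xs! m m′

  ∈-zip-monotone : ∀ {r s} {R : Rel A r} {S : Rel B s} → Asymmetric R →
    ∀ {xs ys} → AllPairs R xs → AllPairs S ys → ∀ {x y x′ y′} →
    (x , y) ∈ₗ zip xs ys → (x′ , y′) ∈ₗ zip xs ys → R x x′ → S y y′
  ∈-zip-monotone asym {_ ∷ _} {_ ∷ _} _ _ (here refl) (here refl) Rxx =
    ⊥-elim (asym Rxx Rxx)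
  ∈-zip-monotone asym {_ ∷ _} {_ ∷ _} _ (y<ys ∷ _) (here refl) (there m) _ =
    All.lookup y<ys (∈-zip⁻ʳ m)
  ∈-zip-monotone asym {_ ∷ _} {_ ∷ _} (x<xs ∷ _) _ (there m) (here refl) Rxx′ =
    ⊥-elim (asym Rxx′ (All.lookup x<xs (∈-zip⁻ˡ m)))
  ∈-zip-monotone asym {_ ∷ _} {_ ∷ _} (_ ∷ xs<) (_ ∷ ys<) (there m) (there m′) =
    ∈-zip-monotone asym xs< ys< m m′

  ∈-zip-map : ∀ {c d} {C : Set c} {D : Set d} (f : A → C) (h : B → D) {xs ys x y} →
    (x , y) ∈ₗ zip xs ys → (f x , h y) ∈ₗ zip (map f xs) (map h ys)
  ∈-zip-map f h {xs} {ys} m =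
    subst ((f _ , h _) ∈ₗ_) (sym (zip-map f h xs ys)) (∈-map⁺ (Product.map f h) m)

  map≡map⇒≡-on-zip : ∀ {c} {C : Set c} (f : A → C) (h : B → C) {xs ys x y} →
    map f xs ≡ map h ys → (x , y) ∈ₗ zip xs ys → f x ≡ h y
  map≡map⇒≡-on-zip f h {_ ∷ _} {_ ∷ _} eq (here refl) = ∷-injectiveˡ eq
  map≡map⇒≡-on-zip f h {_ ∷ _} {_ ∷ _} eq (there m)   =
    map≡map⇒≡-on-zip f h (∷-injectiveʳ eq) m

filter-absorbs : ∀ {a p q} {A : Set a} {P : Pred A p} {Q : Pred A q}
  (P? : Decidable P) (Q? : Decidable Q) → (∀ {x} → P x → Q x) →
  ∀ xs → filter P? (filter Q? xs) ≡ filter P? xs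
filter-absorbs P? Q? P⇒Q []       = refl
filter-absorbs P? Q? P⇒Q (x ∷ xs) with Q? x
... | no ¬Qx = trans (filter-absorbs P? Q? P⇒Q xs) (sym (filter-reject P? (¬Qx ∘ P⇒Q)))
... | yes _ with P? x
...   | yes _ = cong (x ∷_) (filter-absorbs P? Q? P⇒Q xs)
...   | no _  = filter-absorbs P? Q? P⇒Q xs

rank : List ℕ → ℕ → ℕ
rank w x = length (filter (_<? x) w)

rank-mono-≤ : ∀ w {x y} → x ≤ y → rank w x ≤ rank w y
rank-mono-≤ w x≤y = Sublist.length-mono-≤ (Sublist.filter⁺ (_<? _) (_<? _)
  (λ { refl z<x → <-≤-trans z<x x≤y }) (⊆-refl {x = w}))

-- x itself is counted by rank w y but not by rank w x.
rank-mono-< : ∀ w {x y} → x < y → x ∈ₗ w → rank w x < rank w y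
rank-mono-< w {x} {y} x<y x∈w = begin-strict
  rank w x                    ≡⟨ cong length absorbed ⟨
  length (filter (_<? x) w′)  <⟨ filter-notAll (_<? x) w′ x-uncounted ⟩
  rank w y                    ∎
  where
  open ≤-Reasoning
  w′ : List ℕ
  w′ = filter (_<? y) w
  absorbed : filter (_<? x) w′ ≡ filter (_<? x) w
  absorbed = filter-absorbs (_<? x) (_<? y) (λ z<x → <-trans z<x x<y) w
  x-uncounted : Any (λ z → ¬ z < x) w′
  x-uncounted = Any.map (λ { refl → <-irrefl refl }) (∈-filter⁺ (_<? y) x∈w x<y)

rank-cancel-< : ∀ w {x y} → rank w x < rank w y → x < y
rank-cancel-< w rx<ry = ≰⇒> (λ y≤x → <⇒≱ rx<ry (rank-mono-≤ w y≤x))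

std-≡⇒∈-zip-monotone : ∀ {xs ys} → std xs ≡ std ys → ∀ {x y x′ y′} →
  (x , y) ∈ₗ zip xs ys → (x′ , y′) ∈ₗ zip xs ys → x < x′ → y < y′
std-≡⇒∈-zip-monotone {xs} {ys} eq m m′ x<x′ = rank-cancel-< ys
  (subst₂ _<_ (same-rank m) (same-rank m′) (rank-mono-< xs x<x′ (∈-zip⁻ˡ m)))
  where
  same-rank : ∀ {x y} → (x , y) ∈ₗ zip xs ys → rank xs x ≡ rank ys y
  same-rank = map≡map⇒≡-on-zip (rank xs) (rank ys) eq

kept-sorted : ∀ {n} (A : Subset n) → AllPairs Fin._<_ (kept A)
kept-sorted A = AllPairsₚ.filter⁺ _ (AllPairsₚ.tabulate⁺-< (λ i<j → i<j))

value-injective : ∀ {n} (σ : Permutation′ n) {i j} → value σ i ≡ value σ j → i ≡ j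
value-injective σ = Injection.injective (↔⇒↣ σ) ∘ toℕ-injective

module ChainGraph {n} (A B : Subset n) where

  _⟶_ : Fin n → Fin n → Set
  x ⟶ y = (y , x) ∈ₗ zip (kept A) (kept B)

  ⟶-injective : ∀ {x x′ y} → x ⟶ y → x′ ⟶ y → x ≡ x′
  ⟶-injective = ∈-zip-functional (AllPairs.map Finₚ.<⇒≢ (kept-sorted A))

  no-⟶-into-A : ∀ {w r} → r ∈ A → ¬ (w ⟶ r)
  no-⟶-into-A r∈A m = proj₂ (∈-filter⁻ (λ i → ¬? (i ∈? A)) {xs = allFin n} (∈-zip⁻ˡ m)) r∈A

  edge⇒sym : ∀ {p q} → Edge A B p q → SymClosure _⟶_ p q
  edge⇒sym (inj₁ q⟶p , _) = bwd q⟶p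
  edge⇒sym (inj₂ p⟶q , _) = fwd p⟶q

  chain-path : (C : Chain A B) → Star _⟶_ (red C) (blue C)
  chain-path C = reachable-from-source ⟶-injective (no-⟶-into-A (red∈A C)) ε
    (Star.map edge⇒sym (connected C))

  red≢blue : Empty (A ∩ B) → (C : Chain A B) → red C ≢ blue C
  red≢blue disjoint C red≡blue =
    disjoint (red C , x∈p∩q⁺ (red∈A C , subst (_∈ B) (sym red≡blue) (blue∈B C)))

  ⟶-preserves-position : ∀ {x y x′ y′} → x ⟶ y → x′ ⟶ y′ → toℕ y < toℕ y′ → toℕ x < toℕ x′
  ⟶-preserves-position = ∈-zip-monotone Finₚ.<-asym (kept-sorted A) (kept-sorted B)

  ⟶-preserves-value : (σ : Permutation′ n) → delete σ A ≡ delete σ B →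
    ∀ {x y x′ y′} → x ⟶ y → x′ ⟶ y′ → value σ y < value σ y′ → value σ x < value σ x′
  ⟶-preserves-value σ eq m m′ = std-≡⇒∈-zip-monotone eq
    (∈-zip-map (value σ) (value σ) m) (∈-zip-map (value σ) (value σ) m′)

proposition2p17 : (n k : ℕ) (σ : Permutation′ n) (A B : Subset n) →
    ∣ A ∣ ≡ k → ∣ B ∣ ≡ k → Empty (A ∩ B) → delete σ A ≡ delete σ B →
    (C C' : Chain A B) →
      (OverlapH σ C C' →
        (Leftwards σ C × Leftwards σ C') ⊎ (Rightwards σ C × Rightwards σ C'))
      × (OverlapV σ C C' →
        (Upwards σ C × Upwards σ C') ⊎ (Downwards σ C × Downwards σ C'))
proposition2p17 _ _ σ A B _ _ disjoint σ⟨A⟩≡σ⟨B⟩ C C′ =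
    (λ (o , o′) → swap (Horizontal.overlapping-paths-codirected p p′
       (r≢b ∘ toℕ-injective) (r′≢b′ ∘ toℕ-injective) o o′))
  , (λ (o , o′) → Vertical.overlapping-paths-codirected p p′
       (r≢b ∘ value-injective σ) (r′≢b′ ∘ value-injective σ) o o′)
  where
  open ChainGraph A B
  module Horizontal = LevelCrossing toℕ ⟶-preserves-position
  module Vertical   = LevelCrossing (value σ) (⟶-preserves-value σ σ⟨A⟩≡σ⟨B⟩)
  p  = chain-path C
  p′ = chain-path C′
  r≢b  = red≢blue disjoint C
  r′≢b′ = red≢blue disjoint C′
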